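{- Let $r$ be a positive integer, and let $\lambda=(\lambda_1,\dots,\lambda_s)$ be an ordered partition of $r$ into $s<r$ parts. For every ordered partition $\lambda'$ of $r$ into $s+1$ parts with $\lambda\succ\lambda'$, consider some positive integer $M_{\lambda'}$, and let $M=\sum_{\lambda'} M_{\lambda'}$. Let $\mathcal{H}$ be a finite collection of pairwise disjoint subsets $e\subseteq \mathbb{Z}$, each of size $|e|=r$, such that $\mathcal{H}$ is $\lambda$-partite. Then at least one of the following holds: (a) There is a sub-collection $\mathcal{H}^*\subseteq \mathcal{H}$ of size $|\mathcal{H}^*|\ge |\mathcal{H}|/(2M)$ that is interval-wise $\lambda$-partite. (b) For some ordered partition $\lambda'$ of $r$ into $s+1$ parts with $\lambda\succ\lambda'$, there is a sub-collection $\mathcal{H}'\subseteq \mathcal{H}$ of size $|\mathcal{H}'|>M_{\lambda'}$ that is $\lambda'$-partite.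
   Context: An ordered partition of $r$ is a sequence $\lambda=(\lambda_1,\dots,\lambda_s)$ of positive integers with sum $r$ ($s$ is its number of parts). We write $\lambda\succ\lambda'$ if $\lambda'$ is obtained from $\lambda$ by splitting some summands into smaller consecutive sub-summands (without reordering or recombining), i.e. the interval partition of $\{1,\dots,r\}$ given by $\lambda'$ refines that of $\lambda$. A finite collection $\mathcal{H}$ of pairwise disjoint size-$r$ subsets of $\mathbb{Z}$ is $\lambda$-partite if there are $x_0<x_1<\dots<x_s$ in $\mathbb{R}\setminus\mathbb{Z}$ with $|e\cap(x_{i-1},x_i)|=\lambda_i$ for every $e\in\mathcal{H}$ and $i=1,\dots,s$; it is interval-wise $\lambda$-partite if such $x_0<\dots<x_s$ can be chosen so that additionally, for each $i=1,\dots,s$, the intervals $\operatorname{conv}(e\cap(x_{i-1},x_i))$ (convex hulls, i.e. $[\min,\max]$) are pairwise disjoint over $e\in\mathcal{H}$.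
   Formalization: The cut points $x_0<\dots<x_s$ defining λ-partite and interval-wise λ-partite collections lie in ℚ∖ℤ instead of ℝ∖ℤ, and the convex hulls are taken in ℚ. -}

module Defs where

open import Data.Nat as ℕ using (ℕ; zero; suc)
open import Data.Integer as ℤ using (ℤ)
open import Data.Rational as ℚ using (ℚ; _/_)
open import Data.Rational.Properties using (_<?_)
open import Data.List using (List; []; _∷_; _++_; length; filter; map; lookup)
open import Data.Nat.ListAction using (sum)
open import Data.List.Relation.Unary.All using (All)
open import Data.List.Relation.Unary.AllPairs using (AllPairs)
open import Data.List.Relation.Unary.Unique.Propositional using (Unique)
open import Data.List.Membership.Propositional using (_∈_)
open import Data.Fin using (Fin; inject₁) renaming (suc to fsuc)
open import Data.Product using (Σ; ∃; _×_; _,_)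
open import Relation.Nullary using (¬_)
open import Relation.Nullary.Decidable using (_×-dec_)
open import Relation.Binary.PropositionalEquality using (_≡_; _≢_)

ι : ℤ → ℚ
ι z = z / 1

OrderedPartition : ℕ → List ℕ → Set
OrderedPartition r λ′ = All (λ x → 0 ℕ.< x) λ′ × sum λ′ ≡ r

data _≻_ : List ℕ → List ℕ → Set where
  []≻[] : [] ≻ []
  split : ∀ {a λ₁ μ λ₂} → OrderedPartition a μ → λ₁ ≻ λ₂ → (a ∷ λ₁) ≻ (μ ++ λ₂)

IsRSet : ℕ → List ℤ → Set
IsRSet r e = Unique e × length e ≡ r

DisjointSets : List ℤ → List ℤ → Set
DisjointSets e e′ = ∀ z → z ∈ e → z ∈ e′ → Data.Empty.⊥
  where import Data.Empty

IsUniformDisjointFamily : ℕ → List (List ℤ) → Set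
IsUniformDisjointFamily r H = All (IsRSet r) H × AllPairs DisjointSets H

part : ℚ → ℚ → List ℤ → List ℤ
part a b = filter (λ z → (a <? ι z) ×-dec (ι z <? b))

InConv : List ℤ → ℚ → Set
InConv A q = Σ ℤ λ a → Σ ℤ λ b → a ∈ A × b ∈ A × ι a ℚ.≤ q × q ℚ.≤ ι b

ConvDisjoint : List ℤ → List ℤ → Set
ConvDisjoint A B = ∀ q → ¬ (InConv A q × InConv B q)

Cuts : List ℕ → Set
Cuts λ′ = Σ (Fin (suc (length λ′)) → ℚ) λ x →
  (∀ i (z : ℤ) → x i ≢ ι z) × (∀ (i : Fin (length λ′)) → x (inject₁ i) ℚ.< x (fsuc i))

lo hi : (λ′ : List ℕ) → Cuts λ′ → Fin (length λ′) → ℚ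
lo λ′ (x , _) i = x (inject₁ i)
hi λ′ (x , _) i = x (fsuc i)

CutsFit : (λ′ : List ℕ) → Cuts λ′ → List (List ℤ) → Set
CutsFit λ′ c H = All (λ e → ∀ i → length (part (lo λ′ c i) (hi λ′ c i) e) ≡ lookup λ′ i) H

Partite : List ℕ → List (List ℤ) → Set
Partite λ′ H = Σ (Cuts λ′) λ c → CutsFit λ′ c H

IntervalWisePartite : List ℕ → List (List ℤ) → Set
IntervalWisePartite λ′ H = Σ (Cuts λ′) λ c → CutsFit λ′ c H ×
  (∀ i → AllPairs (λ e e′ → ConvDisjoint (part (lo λ′ c i) (hi λ′ c i) e)
                                          (part (lo λ′ c i) (hi λ′ c i) e′)) H)

-- Keep the cuts of λ fixed and let m be the leftmost point of e in block i. Say that e crosses f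
-- when, in some block, f has points both ≤ m and > m. A non-integer cut just right of m then
-- splits the i-th block of f into two non-empty parts, so f is λ′-partite for the refinement λ′
-- of λ splitting part i accordingly; λ′ labels the crossing and determines both i and the split.
-- If some e crosses more than M_λ′ sets with label λ′, these sets all fit the same refined cuts,
-- which is (b). Otherwise each e crosses at most M sets. Each e also crosses itself, since s < r
-- forces a part of size ≥ 2, so repeatedly keeping a set of in- plus out-degree ≤ 2M and
-- discarding its neighbours yields |H|/2M pairwise non-crossing sets. Disjoint non-crossing sets
-- have disjoint convex hulls in every block, which is (a).

module Submission where

open import Defs
open import Data.Nat using (ℕ; _<_; _≤_; _*_; suc)
open import Data.List using (List; length; map)
open import Data.Nat.ListAction using (sum)
open import Data.List.Relation.Unary.All using (All)
open import Data.List.Relation.Unary.Unique.Propositional using (Unique)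
open import Data.List.Membership.Propositional using (_∈_)
open import Data.List.Relation.Binary.Sublist.Propositional using (_⊆_)
open import Data.Integer using (ℤ)
open import Data.Product using (Σ; _×_)
open import Data.Sum using (_⊎_)
open import Relation.Binary.PropositionalEquality using (_≡_)
open import Function.Bundles using (_⇔_)

open import Data.Nat as ℕ using (zero; z≤n; s≤s; _+_; _∸_)
open import Data.Nat.Properties
open import Algebra.Properties.CommutativeSemigroup +-commutativeSemigroup using (interchange)
open import Data.Nat.Coprimality as Coprime using (1-coprimeTo)
open import Data.Integer as ℤ using (0ℤ)
import Data.Integer.Properties as ℤ
open import Data.Rational as ℚ using (ℚ; mkℚ; *<*; *≤*)
import Data.Rational.Properties as ℚ
open import Data.List using ([]; _∷_; _++_; lookup; filter)
open import Data.List.Properties using (map-cong; filter-++; filter-reject; filter-notAll; ∷-injective; ≡-dec)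
open import Data.List.Relation.Unary.All as All using ([]; _∷_)
open import Data.List.Relation.Unary.All.Properties using (all-filter; ++⁺; ++⁻ˡ; ++⁻ʳ)
open import Data.List.Relation.Unary.Any as Any using (Any; here; there)
open import Data.List.Relation.Unary.AllPairs as AllPairs using (AllPairs; []; _∷_)
import Data.List.Relation.Unary.Unique.Propositional.Properties as Unique
open import Data.List.Membership.Propositional using (find; lose)
open import Data.List.Membership.Propositional.Properties using (∈-∃++; ∈-filter⁻; ∈-filter⁺; ∈-length)
open import Data.List.Relation.Binary.Sublist.Propositional using ([]; _∷_; _∷ʳ_; ⊆-trans)
import Data.List.Relation.Binary.Sublist.Propositional.Properties as Sublist
open import Data.List.Extrema ℤ.≤-totalOrder using (min; min≤⊤; min≤xs; argmin-sel)
open import Data.Fin using (Fin; inject₁) renaming (zero to fzero; suc to fsuc)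
import Data.Fin.Properties as Fin
open import Data.Product using (∃; ∃₂; _,_; proj₁; proj₂)
open import Data.Sum using (inj₁; inj₂; [_,_]′)
open import Data.Empty using (⊥-elim)
open import Function using (_∘_; id; flip)
open import Function.Bundles using (Equivalence; mk⇔)
open import Relation.Nullary using (¬_; Dec; yes; no)
open import Relation.Nullary.Decidable using (_×-dec_; ¬?; map′; toSum)
open import Relation.Unary using (Decidable)
open import Relation.Binary.Definitions using (tri<; tri≈; tri>)
open import Relation.Binary.PropositionalEquality using (_≢_; refl; sym; trans; cong; cong₂; subst; subst₂; module ≡-Reasoning)

𝟙 : {P : Set} → Dec P → ℕ
𝟙 (yes _) = 1
𝟙 (no _) = 0

private
  variable
    A B : Set

count : {P : A → Set} → Decidable P → List A → ℕ
count P? xs = length (filter P? xs)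

∃-∈ : {xs : List A} → 0 < length xs → ∃ λ x → x ∈ xs
∃-∈ {xs = x ∷ _} _ = x , here refl

count-∷ : {P : A → Set} (P? : Decidable P) (x : A) (xs : List A) →
          count P? (x ∷ xs) ≡ 𝟙 (P? x) + count P? xs
count-∷ P? x xs with P? x
... | yes _ = refl
... | no _ = refl

count≡sum-𝟙 : {P : A → Set} (P? : Decidable P) (xs : List A) → count P? xs ≡ sum (map (𝟙 ∘ P?) xs)
count≡sum-𝟙 P? [] = refl
count≡sum-𝟙 P? (x ∷ xs) = trans (count-∷ P? x xs) (cong (𝟙 (P? x) +_) (count≡sum-𝟙 P? xs))

count-⊎ : {P Q R : A → Set} (P? : Decidable P) (Q? : Decidable Q) (R? : Decidable R) →
          (∀ x → P x ⇔ (Q x ⊎ R x)) → (∀ {x} → Q x → ¬ R x) → (xs : List A) →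
          count P? xs ≡ count Q? xs + count R? xs
count-⊎ P? Q? R? P⇔Q⊎R Q⇒¬R [] = refl
count-⊎ P? Q? R? P⇔Q⊎R Q⇒¬R (x ∷ xs) with IH ← count-⊎ P? Q? R? P⇔Q⊎R Q⇒¬R xs | P? x | Q? x | R? x
... | yes _  | yes _  | no _   = cong suc IH
... | yes _  | no _   | yes _  = trans (cong suc IH) (sym (+-suc _ _))
... | no _   | no _   | no _   = IH
... | _      | yes qx | yes rx = ⊥-elim (Q⇒¬R qx rx)
... | yes px | no ¬qx | no ¬rx = ⊥-elim ([ ¬qx , ¬rx ]′ (Equivalence.to (P⇔Q⊎R x) px))
... | no ¬px | yes qx | no _   = ⊥-elim (¬px (Equivalence.from (P⇔Q⊎R x) (inj₁ qx)))
... | no ¬px | no _   | yes rx = ⊥-elim (¬px (Equivalence.from (P⇔Q⊎R x) (inj₂ rx)))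

count-mono-⊆ : {P : A → Set} (P? : Decidable P) {xs ys : List A} → xs ⊆ ys → count P? xs ≤ count P? ys
count-mono-⊆ P? xs⊆ys = Sublist.length-mono-≤ (Sublist.filter⁺ P? P? (λ where refl → λ p → p) xs⊆ys)

sum-map-+ : (f g : A → ℕ) (xs : List A) → sum (map (λ x → f x + g x) xs) ≡ sum (map f xs) + sum (map g xs)
sum-map-+ f g [] = refl
sum-map-+ f g (x ∷ xs) = trans (cong (f x + g x +_) (sum-map-+ f g xs)) (interchange (f x) (g x) _ _)

sum-map-mono : (f g : A → ℕ) (xs : List A) → (∀ {x} → x ∈ xs → f x ≤ g x) → sum (map f xs) ≤ sum (map g xs)
sum-map-mono f g [] _ = z≤n
sum-map-mono f g (x ∷ xs) f≤g = +-mono-≤ (f≤g (here refl)) (sum-map-mono f g xs (f≤g ∘ there))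

sum-map-≤-length-* : (f : A → ℕ) (b : ℕ) (xs : List A) → (∀ {x} → x ∈ xs → f x ≤ b) →
                     sum (map f xs) ≤ length xs * b
sum-map-≤-length-* f b [] _ = z≤n
sum-map-≤-length-* f b (x ∷ xs) f≤b = +-mono-≤ (f≤b (here refl)) (sum-map-≤-length-* f b xs (f≤b ∘ there))

≤-sum-map : (f : A → ℕ) {x : A} {xs : List A} → x ∈ xs → f x ≤ sum (map f xs)
≤-sum-map f (here refl) = m≤m+n _ _
≤-sum-map f {xs = y ∷ _} (there x∈xs) = ≤-trans (≤-sum-map f x∈xs) (m≤n+m _ (f y))

length<sum-map : (f : A → ℕ) {y : A} {xs : List A} → (∀ {x} → x ∈ xs → 1 ≤ f x) → y ∈ xs → 2 ≤ f y →
                 length xs < sum (map f xs)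
length<sum-map f {xs = x ∷ xs} 1≤f (here refl) 2≤fy = +-mono-≤ 2≤fy (length≤ xs (1≤f ∘ there))
  where
  length≤ : ∀ xs → (∀ {x} → x ∈ xs → 1 ≤ f x) → length xs ≤ sum (map f xs)
  length≤ [] _ = z≤n
  length≤ (x ∷ xs) 1≤f = +-mono-≤ (1≤f (here refl)) (length≤ xs (1≤f ∘ there))
length<sum-map f {xs = x ∷ xs} 1≤f (there y∈xs) 2≤fy =
  +-mono-≤ (1≤f (here refl)) (length<sum-map f (1≤f ∘ there) y∈xs 2≤fy)

Any-≤-average : (f : A → ℕ) (b : ℕ) (xs : List A) → 0 < length xs → sum (map f xs) ≤ length xs * b →
                  Any (λ x → f x ≤ b) xs
Any-≤-average f b (x ∷ xs) _ Σ≤ with f x ≤? b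
... | yes fx≤b = here fx≤b
Any-≤-average f b (x ∷ []) _ Σ≤ | no fx≰b = ⊥-elim (fx≰b (subst₂ _≤_ (+-identityʳ (f x)) (+-identityʳ b) Σ≤))
Any-≤-average f b (x ∷ y ∷ xs) _ Σ≤ | no fx≰b =
  there (Any-≤-average f b (y ∷ xs) (s≤s z≤n)
          (+-cancelˡ-≤ b _ _ (≤-trans (+-monoˡ-≤ _ (<⇒≤ (≰⇒> fx≰b))) Σ≤)))

sum-map-0 : (xs : List A) → sum (map (λ _ → 0) xs) ≡ 0
sum-map-0 [] = refl
sum-map-0 (_ ∷ xs) = sum-map-0 xs

𝟙-yes : {P : Set} (P? : Dec P) → P → 𝟙 P? ≡ 1
𝟙-yes (yes _) _ = refl
𝟙-yes (no ¬p) p = ⊥-elim (¬p p)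

count-transpose : {R : A → B → Set} (R? : ∀ x y → Dec (R x y)) (xs : List A) (ys : List B) →
                  sum (map (λ y → count (λ x → R? x y) xs) ys) ≡ sum (map (λ x → count (R? x) ys) xs)
count-transpose R? [] ys = sum-map-0 ys
count-transpose R? (x ∷ xs) ys = begin
  sum (map (λ y → count (λ x′ → R? x′ y) (x ∷ xs)) ys)
    ≡⟨ cong sum (map-cong (λ y → count-∷ (λ x′ → R? x′ y) x xs) ys) ⟩
  sum (map (λ y → 𝟙 (R? x y) + count (λ x′ → R? x′ y) xs) ys)
    ≡⟨ sum-map-+ (𝟙 ∘ R? x) _ ys ⟩
  sum (map (𝟙 ∘ R? x) ys) + sum (map (λ y → count (λ x′ → R? x′ y) xs) ys)
    ≡⟨ cong₂ _+_ (sym (count≡sum-𝟙 (R? x) ys)) (count-transpose R? xs ys) ⟩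
  count (R? x) ys + sum (map (λ x′ → count (R? x′) ys) xs) ∎
  where open ≡-Reasoning

count-≤-sum-count : {P : A → Set} {Q : B → A → Set} (P? : Decidable P) (Q? : ∀ l → Decidable (Q l))
                    (ls : List B) (xs : List A) → (∀ {x} → x ∈ xs → P x → ∃ λ l → l ∈ ls × Q l x) →
                    count P? xs ≤ sum (map (λ l → count (Q? l) xs) ls)
count-≤-sum-count P? Q? ls [] _ = z≤n
count-≤-sum-count P? Q? ls (x ∷ xs) classify = begin
  count P? (x ∷ xs)
    ≡⟨ count-∷ P? x xs ⟩
  𝟙 (P? x) + count P? xs
    ≤⟨ +-mono-≤ head (count-≤-sum-count P? Q? ls xs (classify ∘ there)) ⟩
  sum (map (λ l → 𝟙 (Q? l x)) ls) + sum (map (λ l → count (Q? l) xs) ls)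
    ≡⟨ sum-map-+ (λ l → 𝟙 (Q? l x)) (λ l → count (Q? l) xs) ls ⟨
  sum (map (λ l → 𝟙 (Q? l x) + count (Q? l) xs) ls)
    ≡⟨ cong sum (map-cong (λ l → count-∷ (Q? l) x xs) ls) ⟨
  sum (map (λ l → count (Q? l) (x ∷ xs)) ls) ∎
  where
  open ≤-Reasoning
  head : 𝟙 (P? x) ≤ sum (map (λ l → 𝟙 (Q? l x)) ls)
  head with P? x
  ... | no _ = z≤n
  ... | yes px with classify (here refl) px
  ...   | l , l∈ls , qlx = subst (_≤ _) (𝟙-yes (Q? l x) qlx) (≤-sum-map (λ l → 𝟙 (Q? l x)) l∈ls)

⊆-++⁻ : (as bs : List A) {S : List A} → S ⊆ as ++ bs → ∃₂ λ S₁ S₂ → S ≡ S₁ ++ S₂ × S₁ ⊆ as × S₂ ⊆ bs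
⊆-++⁻ [] bs S⊆bs = [] , _ , refl , [] , S⊆bs
⊆-++⁻ (a ∷ as) bs (.a ∷ʳ S⊆) with S₁ , S₂ , refl , S₁⊆ , S₂⊆ ← ⊆-++⁻ as bs S⊆ =
  S₁ , S₂ , refl , a ∷ʳ S₁⊆ , S₂⊆
⊆-++⁻ (a ∷ as) bs (refl ∷ S⊆) with S₁ , S₂ , refl , S₁⊆ , S₂⊆ ← ⊆-++⁻ as bs S⊆ =
  a ∷ S₁ , S₂ , refl , refl ∷ S₁⊆ , S₂⊆

filter-++-reject : {P : A → Set} (P? : Decidable P) (as bs : List A) {e : A} → ¬ P e →
                   filter P? (as ++ e ∷ bs) ≡ filter P? as ++ filter P? bs
filter-++-reject P? as bs ¬pe = trans (filter-++ P? as (_ ∷ bs)) (cong (filter P? as ++_) (filter-reject P? ¬pe))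

length-insert : (xs : List A) {y : A} {ys : List A} → length (xs ++ y ∷ ys) ≡ suc (length (xs ++ ys))
length-insert [] = refl
length-insert (_ ∷ xs) = cong suc (length-insert xs)

module _ {R : A → A → Set} where

  AllPairs-resp-⊆ : {xs ys : List A} → xs ⊆ ys → AllPairs R ys → AllPairs R xs
  AllPairs-resp-⊆ [] [] = []
  AllPairs-resp-⊆ (y ∷ʳ xs⊆ys) (_ ∷ Rys) = AllPairs-resp-⊆ xs⊆ys Rys
  AllPairs-resp-⊆ (refl ∷ xs⊆ys) (Ry ∷ Rys) = Sublist.All-resp-⊆ xs⊆ys Ry ∷ AllPairs-resp-⊆ xs⊆ys Rys

  AllPairs-insert : (S₁ : List A) {e : A} {S₂ : List A} → AllPairs R (S₁ ++ S₂) →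
                    All (flip R e) S₁ → All (R e) S₂ → AllPairs R (S₁ ++ e ∷ S₂)
  AllPairs-insert [] RS₂ [] Re = Re ∷ RS₂
  AllPairs-insert (a ∷ S₁) (Ra ∷ RS) (Rae ∷ RS₁e) Re =
    ++⁺ (++⁻ˡ S₁ Ra) (Rae ∷ ++⁻ʳ S₁ Ra) ∷ AllPairs-insert S₁ RS RS₁e Re

module Digraph {_⇝_ : A → A → Set} (_⇝?_ : ∀ x y → Dec (x ⇝ y)) where

  Apart : A → A → Set
  Apart x y = ¬ x ⇝ y × ¬ y ⇝ x

  apart? : ∀ x y → Dec (Apart x y)
  apart? x y = ¬? (x ⇝? y) ×-dec ¬? (y ⇝? x)

  outdeg indeg : A → List A → ℕ
  outdeg x xs = count (x ⇝?_) xs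
  indeg x xs = count (_⇝? x) xs

  ∃-low-degree : (D : ℕ) (xs : List A) → 0 < length xs → (∀ {x} → x ∈ xs → outdeg x xs ≤ D) →
                 Any (λ x → outdeg x xs + indeg x xs ≤ 2 * D) xs
  ∃-low-degree D xs nonempty out≤D = Any-≤-average _ (2 * D) xs nonempty (begin
    sum (map (λ x → outdeg x xs + indeg x xs) xs)  ≡⟨ sum-map-+ _ _ xs ⟩
    Σout + sum (map (λ x → indeg x xs) xs)          ≡⟨ cong (Σout +_) (count-transpose _⇝?_ xs xs) ⟩
    Σout + Σout                                     ≤⟨ +-mono-≤ Σout≤ Σout≤ ⟩
    length xs * D + length xs * D                   ≡⟨ double (length xs) D ⟩
    length xs * (2 * D)                             ∎)
    where
    open ≤-Reasoning
    Σout : ℕ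
    Σout = sum (map (λ x → outdeg x xs) xs)
    Σout≤ : Σout ≤ length xs * D
    Σout≤ = sum-map-≤-length-* _ D xs out≤D
    double : ∀ n d → n * d + n * d ≡ n * (2 * d)
    double n d = sym (trans (*-distribˡ-+ n d (d + 0)) (cong (λ t → n * d + n * t) (+-identityʳ d)))

  -- The loop x ⇝ x counts x in both degrees, which pays for x itself.
  length<count-apart+deg : {x : A} {xs : List A} → x ∈ xs → x ⇝ x →
                           length xs < count (apart? x) xs + (outdeg x xs + indeg x xs)
  length<count-apart+deg {x} {xs} x∈xs x⇝x = begin-strict
    length xs
      <⟨ length<sum-map weight (λ {y} _ → weight≥1 (x ⇝? y) (y ⇝? x)) x∈xs (weight≥2 (x ⇝? x) x⇝x) ⟩
    sum (map weight xs)
      ≡⟨ sum-map-+ _ _ xs ⟩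
    sum (map (𝟙 ∘ apart? x) xs) + sum (map (λ y → 𝟙 (x ⇝? y) + 𝟙 (y ⇝? x)) xs)
      ≡⟨ cong (sum (map (𝟙 ∘ apart? x) xs) +_) (sum-map-+ _ _ xs) ⟩
    sum (map (𝟙 ∘ apart? x) xs) + (sum (map (𝟙 ∘ (x ⇝?_)) xs) + sum (map (𝟙 ∘ (_⇝? x)) xs))
      ≡⟨ cong₂ _+_ (count≡sum-𝟙 (apart? x) xs)
                   (cong₂ _+_ (count≡sum-𝟙 (x ⇝?_) xs) (count≡sum-𝟙 (_⇝? x) xs)) ⟨
    count (apart? x) xs + (outdeg x xs + indeg x xs) ∎
    where
    open ≤-Reasoning
    weight : A → ℕ
    weight y = 𝟙 (apart? x y) + (𝟙 (x ⇝? y) + 𝟙 (y ⇝? x))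
    weight≥1 : {P Q : Set} (P? : Dec P) (Q? : Dec Q) → 1 ≤ 𝟙 (¬? P? ×-dec ¬? Q?) + (𝟙 P? + 𝟙 Q?)
    weight≥1 (yes _) _ = s≤s z≤n
    weight≥1 (no _) (yes _) = s≤s z≤n
    weight≥1 (no _) (no _) = s≤s z≤n
    weight≥2 : {P : Set} (P? : Dec P) → P → 2 ≤ 𝟙 (¬? P? ×-dec ¬? P?) + (𝟙 P? + 𝟙 P?)
    weight≥2 (yes _) _ = s≤s (s≤s z≤n)
    weight≥2 (no ¬p) p = ⊥-elim (¬p p)

  loop⇒¬apart : {x : A} → x ⇝ x → ¬ Apart x x
  loop⇒¬apart x⇝x (¬x⇝x , _) = ¬x⇝x x⇝x

  ApartSublist : ℕ → List A → Set
  ApartSublist D H = ∃ λ S → S ⊆ H × AllPairs Apart S × length H ≤ 2 * D * length S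

  apart-sublist-insert : (D : ℕ) {e : A} {H : List A} → e ∈ H → e ⇝ e →
                         length H < count (apart? e) H + 2 * D →
                         ApartSublist D (filter (apart? e) H) → ApartSublist D H
  apart-sublist-insert D {e} e∈H e⇝e |H|< (S₂ , S₂⊆ , apartS₂ , |H₂|≤)
    with as , bs , refl ← ∈-∃++ e∈H
    with S₁ , S₃ , refl , S₁⊆ , S₃⊆ ←
           ⊆-++⁻ (filter (apart? e) as) (filter (apart? e) bs)
                 (subst (S₂ ⊆_) (filter-++-reject (apart? e) as bs (loop⇒¬apart e⇝e)) S₂⊆)
    = S₁ ++ e ∷ S₃
    , Sublist.++⁺ (⊆-trans S₁⊆ (Sublist.filter-⊆ (apart? e) as)) (refl ∷ ⊆-trans S₃⊆ (Sublist.filter-⊆ (apart? e) bs))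
    , AllPairs-insert S₁ apartS₂ (All.map swap (Sublist.All-resp-⊆ S₁⊆ (all-filter (apart? e) as)))
                                 (Sublist.All-resp-⊆ S₃⊆ (all-filter (apart? e) bs))
    , |H|≤
    where
    swap : ∀ {x} → Apart e x → Apart x e
    swap (p , q) = q , p
    |H|≤ : length (as ++ e ∷ bs) ≤ 2 * D * length (S₁ ++ e ∷ S₃)
    |H|≤ = begin
      length (as ++ e ∷ bs)                               ≤⟨ <⇒≤ |H|< ⟩
      length (filter (apart? e) (as ++ e ∷ bs)) + 2 * D   ≤⟨ +-monoˡ-≤ (2 * D) |H₂|≤ ⟩
      2 * D * length (S₁ ++ S₃) + 2 * D                   ≡⟨ +-comm _ (2 * D) ⟩
      2 * D + 2 * D * length (S₁ ++ S₃)                   ≡⟨ *-suc (2 * D) _ ⟨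
      2 * D * suc (length (S₁ ++ S₃))                     ≡⟨ cong (2 * D *_) (length-insert S₁) ⟨
      2 * D * length (S₁ ++ e ∷ S₃)                       ∎
      where open ≤-Reasoning

  apart-sublist : (D : ℕ) (H : List A) → (∀ {x} → x ∈ H → x ⇝ x) → (∀ {x} → x ∈ H → outdeg x H ≤ D) →
                  ApartSublist D H
  apart-sublist D H = go (length H) H ≤-refl
    where
    go : (n : ℕ) (H : List A) → length H ≤ n → (∀ {x} → x ∈ H → x ⇝ x) → (∀ {x} → x ∈ H → outdeg x H ≤ D) →
         ApartSublist D H
    go _ [] _ _ _ = [] , [] , [] , z≤n
    go (suc n) H@(_ ∷ _) |H|≤ loops out≤D
      with e , e∈H , low ← find (∃-low-degree D H (s≤s z≤n) out≤D)
      = apart-sublist-insert D e∈H (loops e∈H) |H|< (go n H₂ |H₂|≤n (loops ∘ from-H₂) out₂≤D)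
      where
      H₂ : List A
      H₂ = filter (apart? e) H
      from-H₂ : ∀ {x} → x ∈ H₂ → x ∈ H
      from-H₂ = proj₁ ∘ ∈-filter⁻ (apart? e)
      |H₂|≤n : length H₂ ≤ n
      |H₂|≤n = ≤-pred (≤-trans (filter-notAll (apart? e) H (lose e∈H (loop⇒¬apart (loops e∈H)))) |H|≤)
      out₂≤D : ∀ {x} → x ∈ H₂ → outdeg x H₂ ≤ D
      out₂≤D x∈H₂ = ≤-trans (count-mono-⊆ _ (Sublist.filter-⊆ (apart? e) H)) (out≤D (from-H₂ x∈H₂))
      |H|< : length H < length H₂ + 2 * D
      |H|< = <-≤-trans (length<count-apart+deg e∈H (loops e∈H)) (+-monoʳ-≤ (length H₂) low)

ι≡mkℚ : ∀ z → ι z ≡ mkℚ z 0 (Coprime.sym (1-coprimeTo _))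
ι≡mkℚ z = ℚ.↥p/↧p≡p (mkℚ z 0 _)

ι-mono-< : ∀ {a b} → a ℤ.< b → ι a ℚ.< ι b
ι-mono-< {a} {b} a<b = subst₂ ℚ._<_ (sym (ι≡mkℚ a)) (sym (ι≡mkℚ b))
  (*<* (subst₂ ℤ._<_ (sym (ℤ.*-identityʳ a)) (sym (ℤ.*-identityʳ b)) a<b))

ι-cancel-< : ∀ {a b} → ι a ℚ.< ι b → a ℤ.< b
ι-cancel-< {a} {b} ιa<ιb = subst₂ ℤ._<_ (ℤ.*-identityʳ a) (ℤ.*-identityʳ b)
  (ℚ.drop-*<* (subst₂ ℚ._<_ (ι≡mkℚ a) (ι≡mkℚ b) ιa<ιb))

ι-mono-≤ : ∀ {a b} → a ℤ.≤ b → ι a ℚ.≤ ι b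
ι-mono-≤ {a} {b} a≤b = subst₂ ℚ._≤_ (sym (ι≡mkℚ a)) (sym (ι≡mkℚ b))
  (*≤* (subst₂ ℤ._≤_ (sym (ℤ.*-identityʳ a)) (sym (ℤ.*-identityʳ b)) a≤b))

ι-cancel-≤ : ∀ {a b} → ι a ℚ.≤ ι b → a ℤ.≤ b
ι-cancel-≤ {a} {b} ιa≤ιb = subst₂ ℤ._≤_ (ℤ.*-identityʳ a) (ℤ.*-identityʳ b)
  (ℚ.drop-*≤* (subst₂ ℚ._≤_ (ι≡mkℚ a) (ι≡mkℚ b) ιa≤ιb))

NonInteger : ℚ → Set
NonInteger y = ∀ z → y ≢ ι z

∃-non-integer-between : (z : ℤ) → ∃ λ y → ι z ℚ.< y × y ℚ.< ι (ℤ.suc z) × NonInteger y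
∃-non-integer-between z with y , z<y , y<z+1 ← ℚ.<-dense (ι-mono-< {z} (ℤ.suc[i]≤j⇒i<j ℤ.≤-refl)) =
  y , z<y , y<z+1 , λ where
    w refl → ℤ.<-irrefl refl (ℤ.<-≤-trans (ι-cancel-< {w} y<z+1) (ℤ.i<j⇒suc[i]≤j (ι-cancel-< {z} z<y)))

InOpen : ℚ → ℚ → ℤ → Set
InOpen a b z = a ℚ.< ι z × ι z ℚ.< b

inOpen? : ∀ a b → Decidable (InOpen a b)
inOpen? a b z = (a ℚ.<? ι z) ×-dec (ι z ℚ.<? b)

module _ {a b : ℚ} {e : List ℤ} where

  ∈-part⁻ : ∀ {z} → z ∈ part a b e → z ∈ e × InOpen a b z
  ∈-part⁻ = ∈-filter⁻ (inOpen? a b)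

  ∈-part⁺ : ∀ {z} → z ∈ e → a ℚ.< ι z → ι z ℚ.< b → z ∈ part a b e
  ∈-part⁺ z∈e a<z z<b = ∈-filter⁺ (inOpen? a b) z∈e (a<z , z<b)

part-split : ∀ {a y b} (e : List ℤ) → a ℚ.< y → y ℚ.< b → NonInteger y →
             length (part a b e) ≡ length (part a y e) + length (part y b e)
part-split {a} {y} {b} e a<y y<b y∉ℤ =
  count-⊎ (inOpen? a b) (inOpen? a y) (inOpen? y b) split-at-y (λ (_ , z<y) (y<z , _) → ℚ.<-asym z<y y<z) e
  where
  split-at-y : ∀ z → InOpen a b z ⇔ (InOpen a y z ⊎ InOpen y b z)
  split-at-y z = mk⇔ to from
    where
    to : InOpen a b z → InOpen a y z ⊎ InOpen y b z
    to (a<z , z<b) with ℚ.<-cmp (ι z) y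
    ... | tri< z<y _ _ = inj₁ (a<z , z<y)
    ... | tri≈ _ z≡y _ = ⊥-elim (y∉ℤ z (sym z≡y))
    ... | tri> _ _ y<z = inj₂ (y<z , z<b)
    from : InOpen a y z ⊎ InOpen y b z → InOpen a b z
    from (inj₁ (a<z , z<y)) = a<z , ℚ.<-trans z<y y<b
    from (inj₂ (y<z , z<b)) = ℚ.<-trans a<y y<z , z<b

-- The value on [] is junk: blocks of members of a λ-partite family are non-empty.
least : List ℤ → ℤ
least [] = 0ℤ
least (x ∷ xs) = min x xs

least-≤ : ∀ {z xs} → z ∈ xs → least xs ℤ.≤ z
least-≤ {xs = x ∷ xs} (here refl) = min≤⊤ x xs
least-≤ {xs = x ∷ xs} (there z∈xs) = All.lookup (min≤xs x xs) z∈xs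

least-∈ : ∀ {z xs} → z ∈ xs → least xs ∈ xs
least-∈ {xs = x ∷ xs} _ with argmin-sel id x xs
... | inj₁ min≡x = here min≡x
... | inj₂ min∈xs = there min∈xs

∃-above-least : ∀ {xs} → Unique xs → 2 ℕ.≤ length xs → Any (least xs ℤ.<_) xs
∃-above-least {u ∷ v ∷ ws} ((u≢v ∷ _) ∷ _) _ with least (u ∷ v ∷ ws) ℤ.≟ u
... | yes m≡u =
  there (here (ℤ.≤∧≢⇒< (least-≤ {xs = u ∷ v ∷ ws} (there (here refl))) λ m≡v → u≢v (trans (sym m≡u) m≡v)))
... | no m≢u = here (ℤ.≤∧≢⇒< (least-≤ {xs = u ∷ v ∷ ws} (here refl)) m≢u)
∃-above-least {_ ∷ []} _ (s≤s ())

splitPart : (ps : List ℕ) → Fin (length ps) → ℕ → List ℕ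
splitPart (p ∷ ps) fzero k = k ∷ (p ∸ k) ∷ ps
splitPart (p ∷ ps) (fsuc i) k = p ∷ splitPart ps i k

length-splitPart : ∀ ps i k → length (splitPart ps i k) ≡ suc (length ps)
length-splitPart (p ∷ ps) fzero k = refl
length-splitPart (p ∷ ps) (fsuc i) k = cong suc (length-splitPart ps i k)

splitPart-orderedPartition : ∀ {r} ps i {k} → OrderedPartition r ps → 0 < k → k < lookup ps i →
                             OrderedPartition r (splitPart ps i k)
splitPart-orderedPartition ps i {k} (pos , refl) 0<k k<pᵢ = positive ps i pos k<pᵢ , sum-splitPart ps i k<pᵢ
  where
  positive : ∀ ps i → All (0 <_) ps → k < lookup ps i → All (0 <_) (splitPart ps i k)
  positive (p ∷ ps) fzero (_ ∷ pos) k<p = 0<k ∷ m<n⇒0<n∸m k<p ∷ pos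
  positive (p ∷ ps) (fsuc i) (0<p ∷ pos) k<pᵢ = 0<p ∷ positive ps i pos k<pᵢ
  sum-splitPart : ∀ ps i → k < lookup ps i → sum (splitPart ps i k) ≡ sum ps
  sum-splitPart (p ∷ ps) fzero k<p = trans (sym (+-assoc k (p ∸ k) (sum ps))) (cong (_+ sum ps) (m+[n∸m]≡n (<⇒≤ k<p)))
  sum-splitPart (p ∷ ps) (fsuc i) k<pᵢ = cong (p +_) (sum-splitPart ps i k<pᵢ)

≻-refl : ∀ {ps} → All (0 <_) ps → ps ≻ ps
≻-refl [] = []≻[]
≻-refl {p ∷ _} (0<p ∷ pos) = split ((0<p ∷ []) , +-identityʳ p) (≻-refl pos)

≻-splitPart : ∀ ps i {k} → All (0 <_) ps → 0 < k → k < lookup ps i → ps ≻ splitPart ps i k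
≻-splitPart (p ∷ ps) fzero {k} (_ ∷ pos) 0<k k<p =
  split ((0<k ∷ m<n⇒0<n∸m k<p ∷ []) , trans (cong (k +_) (+-identityʳ (p ∸ k))) (m+[n∸m]≡n (<⇒≤ k<p))) (≻-refl pos)
≻-splitPart (p ∷ ps) (fsuc i) (0<p ∷ pos) 0<k k<pᵢ = split ((0<p ∷ []) , +-identityʳ p) (≻-splitPart ps i pos 0<k k<pᵢ)

splitPart-injective : ∀ ps i j {k l} → k < lookup ps i → l < lookup ps j →
                      splitPart ps i k ≡ splitPart ps j l → i ≡ j × k ≡ l
splitPart-injective (p ∷ ps) fzero fzero _ _ eq = refl , proj₁ (∷-injective eq)
splitPart-injective (p ∷ ps) fzero (fsuc j) k<p _ eq = ⊥-elim (<-irrefl (proj₁ (∷-injective eq)) k<p)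
splitPart-injective (p ∷ ps) (fsuc i) fzero _ l<p eq = ⊥-elim (<-irrefl (sym (proj₁ (∷-injective eq))) l<p)
splitPart-injective (p ∷ ps) (fsuc i) (fsuc j) k<pᵢ l<pⱼ eq
  with refl , refl ← splitPart-injective ps i j k<pᵢ l<pⱼ (proj₂ (∷-injective eq)) = refl , refl

∃-part≥2 : ∀ {ps} → All (0 <_) ps → length ps < sum ps → ∃ λ i → 2 ≤ lookup ps i
∃-part≥2 {suc (suc p) ∷ ps} _ _ = fzero , s≤s (s≤s z≤n)
∃-part≥2 {zero ∷ ps} (() ∷ _) _
∃-part≥2 {suc zero ∷ ps} (_ ∷ pos) (s≤s |ps|<Σps) with i , 2≤pᵢ ← ∃-part≥2 pos |ps|<Σps = fsuc i , 2≤pᵢ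

insertCut : (ps : List ℕ) (i : Fin (length ps)) (k : ℕ) → ℚ →
            (Fin (suc (length ps)) → ℚ) → Fin (suc (length (splitPart ps i k))) → ℚ
insertCut ps i k y x fzero = x fzero
insertCut (p ∷ ps) fzero k y x (fsuc fzero) = y
insertCut (p ∷ ps) fzero k y x (fsuc (fsuc j)) = x (fsuc j)
insertCut (p ∷ ps) (fsuc i) k y x (fsuc j) = insertCut ps i k y (x ∘ fsuc) j

insertCut-all : {P : ℚ → Set} (ps : List ℕ) (i : Fin (length ps)) (k : ℕ) {y : ℚ} {x : Fin (suc (length ps)) → ℚ} →
                P y → (∀ j → P (x j)) → ∀ j → P (insertCut ps i k y x j)
insertCut-all ps i k Py Px fzero = Px fzero
insertCut-all (p ∷ ps) fzero k Py Px (fsuc fzero) = Py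
insertCut-all (p ∷ ps) fzero k Py Px (fsuc (fsuc j)) = Px (fsuc j)
insertCut-all {P} (p ∷ ps) (fsuc i) k Py Px (fsuc j) = insertCut-all {P} ps i k Py (Px ∘ fsuc) j

insertCut-consecutive : {R : ℚ → ℚ → ℕ → Set} (ps : List ℕ) (i : Fin (length ps)) (k : ℕ) {y : ℚ}
                        {x : Fin (suc (length ps)) → ℚ} →
                        (∀ j → R (x (inject₁ j)) (x (fsuc j)) (lookup ps j)) →
                        R (x (inject₁ i)) y k → R y (x (fsuc i)) (lookup ps i ∸ k) →
                        ∀ j → R (insertCut ps i k y x (inject₁ j)) (insertCut ps i k y x (fsuc j))
                                (lookup (splitPart ps i k) j)
insertCut-consecutive (p ∷ ps) fzero k Rx Rleft Rright fzero = Rleft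
insertCut-consecutive (p ∷ ps) fzero k Rx Rleft Rright (fsuc fzero) = Rright
insertCut-consecutive (p ∷ ps) fzero k Rx Rleft Rright (fsuc (fsuc j)) = Rx (fsuc j)
insertCut-consecutive (p ∷ ps) (fsuc i) k Rx Rleft Rright fzero = Rx fzero
insertCut-consecutive {R} (p ∷ ps) (fsuc i) k Rx Rleft Rright (fsuc j) =
  insertCut-consecutive {R} ps i k (Rx ∘ fsuc) Rleft Rright j

FitsCuts : (ps : List ℕ) → Cuts ps → List ℤ → Set
FitsCuts ps c e = ∀ i → length (part (lo ps c i) (hi ps c i) e) ≡ lookup ps i

module _ (ps : List ℕ) (c : Cuts ps) (i : Fin (length ps)) (k : ℕ) {y : ℚ} (y∉ℤ : NonInteger y)
         (lo<y : lo ps c i ℚ.< y) (y<hi : y ℚ.< hi ps c i) where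

  refineCuts : Cuts (splitPart ps i k)
  refineCuts = insertCut ps i k y (proj₁ c) ,
               insertCut-all {P = NonInteger} ps i k y∉ℤ (proj₁ (proj₂ c)) ,
               insertCut-consecutive {R = λ a b _ → a ℚ.< b} ps i k (proj₂ (proj₂ c)) lo<y y<hi

  refineCuts-fits : ∀ {e} → FitsCuts ps c e → length (part (lo ps c i) y e) ≡ k →
                    length (part y (hi ps c i) e) ≡ lookup ps i ∸ k → FitsCuts (splitPart ps i k) refineCuts e
  refineCuts-fits {e} = insertCut-consecutive {R = λ a b n → length (part a b e) ≡ n} ps i k

module Crossing (ps : List ℕ) (c : Cuts ps) where

  block : Fin (length ps) → List ℤ → List ℤ
  block i e = part (lo ps c i) (hi ps c i) e

  leftmost : Fin (length ps) → List ℤ → ℤ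
  leftmost i e = least (block i e)

  record Straddles (i : Fin (length ps)) (e f : List ℤ) : Set where
    constructor straddle
    field
      reaches-below : Any (ℤ._≤ leftmost i e) (block i f)
      reaches-above : Any (leftmost i e ℤ.<_) (block i f)

  straddles? : ∀ i e f → Dec (Straddles i e f)
  straddles? i e f = map′ (λ (p , q) → straddle p q) (λ (straddle p q) → p , q)
    (Any.any? (ℤ._≤? leftmost i e) (block i f) ×-dec Any.any? (leftmost i e ℤ.<?_) (block i f))

  Crosses : List ℤ → List ℤ → Set
  Crosses e f = ∃ λ i → Straddles i e f

  crosses? : ∀ e f → Dec (Crosses e f)
  crosses? e f = Fin.any? λ i → straddles? i e f

  -- As a cut, pivot i e separates the points ≤ leftmost i e from the larger ones.
  pivot : Fin (length ps) → List ℤ → ℚ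
  pivot i e = proj₁ (∃-non-integer-between (leftmost i e))

  below above : Fin (length ps) → List ℤ → List ℤ → ℕ
  below i e f = length (part (lo ps c i) (pivot i e) f)
  above i e f = length (part (pivot i e) (hi ps c i) f)

  pivot∉ℤ : ∀ i e → NonInteger (pivot i e)
  pivot∉ℤ i e = proj₂ (proj₂ (proj₂ (∃-non-integer-between (leftmost i e))))

  leftmost<pivot : ∀ i e → ι (leftmost i e) ℚ.< pivot i e
  leftmost<pivot i e = proj₁ (proj₂ (∃-non-integer-between (leftmost i e)))

  pivot<leftmost+1 : ∀ i e → pivot i e ℚ.< ι (ℤ.suc (leftmost i e))
  pivot<leftmost+1 i e = proj₁ (proj₂ (proj₂ (∃-non-integer-between (leftmost i e))))

  ≤leftmost⇒<pivot : ∀ i e {a} → a ℤ.≤ leftmost i e → ι a ℚ.< pivot i e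
  ≤leftmost⇒<pivot i e {a} a≤m = ℚ.≤-<-trans (ι-mono-≤ {a} a≤m) (leftmost<pivot i e)

  leftmost<⇒pivot< : ∀ i e {b} → leftmost i e ℤ.< b → pivot i e ℚ.< ι b
  leftmost<⇒pivot< i e {b} m<b = ℚ.<-≤-trans (pivot<leftmost+1 i e) (ι-mono-≤ {b = b} (ℤ.i<j⇒suc[i]≤j m<b))

  module _ {i : Fin (length ps)} {e f : List ℤ} where

    pivot-inside : Straddles i e f → lo ps c i ℚ.< pivot i e × pivot i e ℚ.< hi ps c i
    pivot-inside (straddle ≤m >m) =
      let _ , a∈ , a≤m = find ≤m
          _ , b∈ , m<b = find >m
          _ , lo<a , _ = ∈-part⁻ {e = f} a∈
          _ , _ , b<hi = ∈-part⁻ {e = f} b∈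
      in ℚ.<-trans lo<a (≤leftmost⇒<pivot i e a≤m) , ℚ.<-trans (leftmost<⇒pivot< i e m<b) b<hi

    below-pos : Straddles i e f → 0 < below i e f
    below-pos (straddle ≤m _) =
      let _ , a∈ , a≤m = find ≤m
          a∈f , lo<a , _ = ∈-part⁻ {e = f} a∈
      in ∈-length (∈-part⁺ a∈f lo<a (≤leftmost⇒<pivot i e a≤m))

    above-pos : Straddles i e f → 0 < above i e f
    above-pos (straddle _ >m) =
      let _ , b∈ , m<b = find >m
          b∈f , _ , b<hi = ∈-part⁻ {e = f} b∈
      in ∈-length (∈-part⁺ b∈f (leftmost<⇒pivot< i e m<b) b<hi)

    part≡below+above : FitsCuts ps c f → Straddles i e f → lookup ps i ≡ below i e f + above i e f
    part≡below+above fits st =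
      trans (sym (fits i)) (part-split f (proj₁ (pivot-inside st)) (proj₂ (pivot-inside st)) (pivot∉ℤ i e))

    below<part : FitsCuts ps c f → Straddles i e f → below i e f < lookup ps i
    below<part fits st = subst (below i e f <_) (sym (part≡below+above fits st)) (m<m+n _ (above-pos st))

    above≡part∸below : FitsCuts ps c f → Straddles i e f → above i e f ≡ lookup ps i ∸ below i e f
    above≡part∸below fits st =
      trans (sym (m+n∸m≡n (below i e f) _)) (cong (_∸ below i e f) (sym (part≡below+above fits st)))

  Labels : List ℤ → List ℕ → List ℤ → Set
  Labels e l f = ∃ λ i → Straddles i e f × splitPart ps i (below i e f) ≡ l

  labels? : ∀ e l f → Dec (Labels e l f)
  labels? e l f = Fin.any? λ i → straddles? i e f ×-dec ≡-dec ℕ._≟_ (splitPart ps i (below i e f)) l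

  crossing-label : ∀ {r e f} → OrderedPartition r ps → FitsCuts ps c f → Crosses e f →
                   ∃ λ l → (OrderedPartition r l × length l ≡ suc (length ps) × ps ≻ l) × Labels e l f
  crossing-label {e = e} {f} op fits (i , st) =
    splitPart ps i (below i e f) ,
    (splitPart-orderedPartition ps i op (below-pos st) (below<part fits st) ,
     length-splitPart ps i (below i e f) ,
     ≻-splitPart ps i (proj₁ op) (below-pos st) (below<part fits st)) ,
    i , st , refl

  -- By splitPart-injective, every member of a class splits the same block at the same place.
  class-partite : ∀ {H e l f₀ i₀} → All (FitsCuts ps c) H → f₀ ∈ H → Straddles i₀ e f₀ →
                  splitPart ps i₀ (below i₀ e f₀) ≡ l → Partite (splitPart ps i₀ (below i₀ e f₀)) (filter (labels? e l) H)
  class-partite {H} {e} {l} {f₀} {i₀} fits f₀∈H st₀ eq₀ = c′ , All.tabulate fits-refined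
    where
    k₀ : ℕ
    k₀ = below i₀ e f₀
    c′ : Cuts (splitPart ps i₀ k₀)
    c′ = refineCuts ps c i₀ k₀ (pivot∉ℤ i₀ e) (proj₁ (pivot-inside st₀)) (proj₂ (pivot-inside st₀))
    fits-same-split : ∀ {f i} → FitsCuts ps c f → Straddles i e f → i ≡ i₀ → below i e f ≡ k₀ →
                      FitsCuts (splitPart ps i₀ k₀) c′ f
    fits-same-split {f} fits-f st refl k≡k₀ =
      refineCuts-fits ps c i₀ k₀ (pivot∉ℤ i₀ e) (proj₁ (pivot-inside st₀)) (proj₂ (pivot-inside st₀)) {f} fits-f k≡k₀
        (trans (above≡part∸below fits-f st) (cong (lookup ps i₀ ∸_) k≡k₀))
    fits-refined : ∀ {f} → f ∈ filter (labels? e l) H → FitsCuts (splitPart ps i₀ k₀) c′ f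
    fits-refined f∈ =
      let f∈H , i , st , eq = ∈-filter⁻ (labels? e l) {xs = H} f∈
          fits-f = All.lookup fits f∈H
          i≡i₀ , k≡k₀ = splitPart-injective ps i i₀ (below<part fits-f st) (below<part (All.lookup fits f₀∈H) st₀)
                                            (trans eq (sym eq₀))
      in fits-same-split fits-f st i≡i₀ k≡k₀

  labelled-partite : ∀ {H} e l → All (FitsCuts ps c) H → 0 < count (labels? e l) H → Partite l (filter (labels? e l) H)
  labelled-partite {H} e l fits nonempty =
    let _ , f₀∈ = ∃-∈ nonempty
        f₀∈H , _ , st₀ , eq₀ = ∈-filter⁻ (labels? e l) {xs = H} f₀∈
    in subst (λ l′ → Partite l′ (filter (labels? e l) H)) eq₀ (class-partite fits f₀∈H st₀ eq₀)

  self-straddles : ∀ {e i} → Unique e → FitsCuts ps c e → 2 ≤ lookup ps i → Straddles i e e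
  self-straddles {e} {i} unique fits 2≤pᵢ =
    let above-m = ∃-above-least (Unique.filter⁺ _ unique) (subst (2 ≤_) (sym (fits i)) 2≤pᵢ)
    in straddle (lose (least-∈ (proj₁ (proj₂ (find above-m)))) ℤ.≤-refl) above-m

  hulls-meet⇒straddles : ∀ {i e f q} → DisjointSets e f → InConv (block i e) q → InConv (block i f) q →
                         leftmost i f ℤ.≤ leftmost i e → Straddles i e f
  hulls-meet⇒straddles {i} {e} {f} disjoint (a₁ , _ , a₁∈ , _ , a₁≤q , _) (a₂ , b₂ , a₂∈ , b₂∈ , _ , q≤b₂) mf≤me =
    straddle (lose (least-∈ a₂∈) mf≤me) (lose b₂∈ (ℤ.≤∧≢⇒< me≤b₂ me≢b₂))
    where
    me≤b₂ : leftmost i e ℤ.≤ b₂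
    me≤b₂ = ℤ.≤-trans (least-≤ a₁∈) (ι-cancel-≤ {a₁} (ℚ.≤-trans a₁≤q q≤b₂))
    me≢b₂ : leftmost i e ≢ b₂
    me≢b₂ refl = disjoint _ (proj₁ (∈-part⁻ {e = e} (least-∈ a₁∈))) (proj₁ (∈-part⁻ {e = f} b₂∈))

  apart⇒hulls-disjoint : ∀ {e f} → DisjointSets e f → ¬ Crosses e f → ¬ Crosses f e →
                         ∀ i → ConvDisjoint (block i e) (block i f)
  apart⇒hulls-disjoint {e} {f} disjoint e↛f f↛e i q (q∈hull-e , q∈hull-f)
    with ℤ.≤-total (leftmost i f) (leftmost i e)
  ... | inj₁ mf≤me = e↛f (i , hulls-meet⇒straddles disjoint q∈hull-e q∈hull-f mf≤me)
  ... | inj₂ me≤mf = f↛e (i , hulls-meet⇒straddles (λ z z∈f z∈e → disjoint z z∈e z∈f) q∈hull-f q∈hull-e me≤mf)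

  LargeClass : List (List ℤ) → List (List ℕ) → (List ℕ → ℕ) → Set
  LargeClass H L Mf = Any (λ e → Any (λ l → Mf l < count (labels? e l) H) L) H

  largeClass? : ∀ H L Mf → Dec (LargeClass H L Mf)
  largeClass? H L Mf = Any.any? (λ e → Any.any? (λ l → Mf l <? count (labels? e l) H) L) H

  large-class⇒partite : ∀ {H L Mf} → All (FitsCuts ps c) H → LargeClass H L Mf →
    Σ (List ℕ) λ l → l ∈ L × Σ (List (List ℤ)) λ H′ → H′ ⊆ H × Mf l < length H′ × Partite l H′
  large-class⇒partite {H} fits large =
    let e , _ , large-l = find large
        l , l∈L , Mf<count = find large-l
    in l , l∈L , filter (labels? e l) H , Sublist.filter-⊆ (labels? e l) H , Mf<count ,
       labelled-partite e l fits (≤-<-trans z≤n Mf<count)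

  no-large-class⇒interval-wise : ∀ {H L Mf} →
    All (FitsCuts ps c) H → AllPairs DisjointSets H → (∀ {e} → e ∈ H → Crosses e e) →
    (∀ {e f} → e ∈ H → f ∈ H → Crosses e f → ∃ λ l → l ∈ L × Labels e l f) → ¬ LargeClass H L Mf →
    Σ (List (List ℤ)) λ H* → H* ⊆ H × length H ≤ 2 * sum (map Mf L) * length H* × IntervalWisePartite ps H*
  no-large-class⇒interval-wise {H} {L} {Mf} fits disjoint loops labelled ¬large =
    interval-wise (apart-sublist M H loops outdeg≤M)
    where
    open Digraph crosses?
    M : ℕ
    M = sum (map Mf L)
    outdeg≤M : ∀ {e} → e ∈ H → outdeg e H ≤ M
    outdeg≤M e∈H = ≤-trans (count-≤-sum-count (crosses? _) (labels? _) L H (labelled e∈H))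
                           (sum-map-mono _ Mf L λ l∈L → ≮⇒≥ λ Mf<count → ¬large (lose e∈H (lose l∈L Mf<count)))
    interval-wise : ApartSublist M H →
                    Σ (List (List ℤ)) λ H* → H* ⊆ H × length H ≤ 2 * M * length H* × IntervalWisePartite ps H*
    interval-wise (S , S⊆H , apart , |H|≤) =
      S , S⊆H , |H|≤ , c , Sublist.All-resp-⊆ S⊆H fits ,
      λ i → AllPairs.zipWith (λ ((e↛f , f↛e) , disjoint) → apart⇒hulls-disjoint disjoint e↛f f↛e i)
                             (apart , AllPairs-resp-⊆ S⊆H disjoint)

proposition3p3 : (r : ℕ) → 0 < r → (λ₀ : List ℕ) → OrderedPartition r λ₀ → length λ₀ < r →
    (L : List (List ℕ)) → Unique L →
    (∀ λ′ → λ′ ∈ L ⇔ (OrderedPartition r λ′ × length λ′ ≡ suc (length λ₀) × λ₀ ≻ λ′)) →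
    (Mf : List ℕ → ℕ) → All (λ λ′ → 0 < Mf λ′) L →
    (H : List (List ℤ)) → IsUniformDisjointFamily r H → Partite λ₀ H →
    (Σ (List (List ℤ)) λ H* → H* ⊆ H × length H ≤ 2 * sum (map Mf L) * length H* × IntervalWisePartite λ₀ H*)
    ⊎ (Σ (List ℕ) λ λ′ → λ′ ∈ L × Σ (List (List ℤ)) λ H′ → H′ ⊆ H × Mf λ′ < length H′ × Partite λ′ H′)
proposition3p3 r _ λ₀ op@(pos , Σλ₀≡r) s<r L _ L-spec Mf _ H (uniform , disjoint) (c , fits) =
  [ inj₂ ∘ large-class⇒partite fits , inj₁ ∘ no-large-class⇒interval-wise fits disjoint loops labelled ]′
    (toSum (largeClass? H L Mf))
  where
  open Crossing λ₀ c
  loops : ∀ {e} → e ∈ H → Crosses e e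
  loops e∈H =
    let i , 2≤λᵢ = ∃-part≥2 pos (subst (length λ₀ <_) (sym Σλ₀≡r) s<r)
    in i , self-straddles (proj₁ (All.lookup uniform e∈H)) (All.lookup fits e∈H) 2≤λᵢ
  labelled : ∀ {e f} → e ∈ H → f ∈ H → Crosses e f → ∃ λ l → l ∈ L × Labels e l f
  labelled e∈H f∈H crosses =
    let l , spec , labels = crossing-label op (All.lookup fits f∈H) crosses
    in l , Equivalence.from (L-spec l) spec , labels
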